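{- Let $A=\begin{pmatrix} a & b \\ c & 0 \end{pmatrix}\in M_2(\mathbb{Z})$ with $bc\neq 0$ and $\gcd(a,b,c)=1$, let $K=\mathbb{Q}(\sqrt{a^2+4bc})$ with ring of integers $\mathcal{O}_K$, let $u,v,w$ be nonzero integers with $\gcd(u,v,w)=1$, and let $i,j,k$ be positive integers. Consider the matrix equation $uX^i+vY^j=wZ^k$ with $X,Y,Z\in C(A)$, a solution being non-trivial if $\det(XYZ)\neq 0$, and the equation $ux^i+vy^j=wz^k$, a solution being non-trivial if $xyz\neq 0$. 1) If $a^2+4bc$ is the square of an integer, then the matrix equation has a non-trivial solution in $C(A)$ if and only if $ux^i+vy^j=wz^k$ has a non-trivial solution with $x,y,z\in\mathbb{Z}$. 2) If $a^2+4bc$ is not a square and $D$ is the unique square-free integer such that $a^2+4bc=m^2D$ for some positive integer $m$, then the matrix equation has a non-trivial solution in $C(A)$ if and only if $ux^i+vy^j=wz^k$ has a non-trivial solution $(x,y,z)$ with $x,y,z\in\mathcal{O}_K$ each of which can be written in the form $\frac{s+t\sqrt{D}}{2}$ with $s,t\in\mathbb{Z}$ and $m\mid t$.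
   Context: $C(A)=\{B\in M_2(\mathbb{Z}): AB=BA\}$. -}

module Defs where

open import Data.Nat as ℕ using (ℕ; zero; suc)
open import Data.Fin using (Fin)
open import Data.Integer as ℤ using (ℤ; +_; ∣_∣)
open import Data.Integer.Divisibility using (_∣_)
open import Data.Integer.GCD using (gcd)
open import Data.Rational as ℚ using (ℚ; 0ℚ)
open import Data.Product using (Σ; ∃; _×_; _,_)
open import Relation.Binary.PropositionalEquality using (_≡_; _≢_)

record M₂ : Set where
  constructor mat
  field
    e₁₁ e₁₂ e₂₁ e₂₂ : ℤ
open M₂ public

infixl 6 _⊕_
infixl 7 _⊗_ _·_

_⊕_ : M₂ → M₂ → M₂
mat a b c d ⊕ mat a' b' c' d' = mat (a ℤ.+ a') (b ℤ.+ b') (c ℤ.+ c') (d ℤ.+ d')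

_⊗_ : M₂ → M₂ → M₂
mat a b c d ⊗ mat a' b' c' d' =
  mat (a ℤ.* a' ℤ.+ b ℤ.* c') (a ℤ.* b' ℤ.+ b ℤ.* d')
      (c ℤ.* a' ℤ.+ d ℤ.* c') (c ℤ.* b' ℤ.+ d ℤ.* d')

_·_ : ℤ → M₂ → M₂
s · mat a b c d = mat (s ℤ.* a) (s ℤ.* b) (s ℤ.* c) (s ℤ.* d)

I₂ : M₂
I₂ = mat (+ 1) (+ 0) (+ 0) (+ 1)

_^ᴹ_ : M₂ → ℕ → M₂
X ^ᴹ zero  = I₂
X ^ᴹ suc n = X ⊗ (X ^ᴹ n)

det : M₂ → ℤ
det (mat a b c d) = a ℤ.* d ℤ.- b ℤ.* c

_∈C_ : M₂ → M₂ → Set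
B ∈C A = A ⊗ B ≡ B ⊗ A

MatrixEqSolvable : (A : M₂) (u v w : ℤ) (i j k : ℕ) → Set
MatrixEqSolvable A u v w i j k =
  Σ M₂ λ X → Σ M₂ λ Y → Σ M₂ λ Z →
    X ∈C A × Y ∈C A × Z ∈C A ×
    (u · (X ^ᴹ i) ⊕ v · (Y ^ᴹ j) ≡ w · (Z ^ᴹ k)) ×
    det (X ⊗ Y ⊗ Z) ≢ + 0

IntEqSolvable : (u v w : ℤ) (i j k : ℕ) → Set
IntEqSolvable u v w i j k =
  Σ ℤ λ x → Σ ℤ λ y → Σ ℤ λ z →
    (u ℤ.* x ℤ.^ i ℤ.+ v ℤ.* y ℤ.^ j ≡ w ℤ.* z ℤ.^ k) ×
    x ℤ.* y ℤ.* z ≢ + 0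

IsSquare : ℤ → Set
IsSquare n = Σ ℤ λ r → n ≡ r ℤ.* r

SquareFree : ℤ → Set
SquareFree D = (r : ℤ) → (r ℤ.* r) ∣ D → ∣ r ∣ ≡ 1

-- The quadratic field K = ℚ(√D), D a non-square: elements p + q√D, p q ∈ ℚ

record K (D : ℤ) : Set where
  constructor _+√_
  field
    re im : ℚ
open K public

module _ {D : ℤ} where
  ℚD : ℚ
  ℚD = D ℚ./ 1

  0K : K D
  0K = 0ℚ +√ 0ℚ

  1K : K D
  1K = ℚ.1ℚ +√ 0ℚ

  _+K_ : K D → K D → K D
  (p +√ q) +K (p' +√ q') = (p ℚ.+ p') +√ (q ℚ.+ q')

  _*K_ : K D → K D → K D
  (p +√ q) *K (p' +√ q') =
    (p ℚ.* p' ℚ.+ ℚD ℚ.* (q ℚ.* q')) +√ (p ℚ.* q' ℚ.+ q ℚ.* p')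

  ιK : ℤ → K D
  ιK n = (n ℚ./ 1) +√ 0ℚ

  _^K_ : K D → ℕ → K D
  x ^K zero  = 1K
  x ^K suc n = x *K (x ^K n)

  polySum : (n : ℕ) → (Fin n → ℤ) → K D → K D
  polySum zero    c x = 0K
  polySum (suc n) c x = (ιK (c Fin.zero) *K (x ^K 0)) +K
                        (x *K polySum n (λ l → c (Fin.suc l)) x)
    where import Data.Fin as Fin

IsAlgebraicInteger : (D : ℤ) → K D → Set
IsAlgebraicInteger D x =
  Σ ℕ λ n → Σ (Fin (suc n) → ℤ) λ c →
    (x ^K suc n) +K polySum (suc n) c x ≡ 0K

HalfFormDiv : (D : ℤ) (m : ℕ) → K D → Set
HalfFormDiv D m x =
  Σ ℤ λ s → Σ ℤ λ t → (+ m ∣ t) × (x ≡ ((s ℚ./ 2) +√ (t ℚ./ 2)))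

QuadEqSolvable : (D : ℤ) (m : ℕ) (u v w : ℤ) (i j k : ℕ) → Set
QuadEqSolvable D m u v w i j k =
  Σ (K D) λ x → Σ (K D) λ y → Σ (K D) λ z →
    IsAlgebraicInteger D x × IsAlgebraicInteger D y × IsAlgebraicInteger D z ×
    HalfFormDiv D m x × HalfFormDiv D m y × HalfFormDiv D m z ×
    ((ιK u *K (x ^K i)) +K (ιK v *K (y ^K j)) ≡ ιK w *K (z ^K k)) ×
    (x *K y) *K z ≢ 0K

module Submission where

-- Since gcd (a, b, c) = 1, every matrix commuting with A is s I + t A, so s + tθ ↦ s I + t A
-- identifies C(A) with the ring ℤ[θ], θ² = aθ + bc, and det with the norm s² + ast − bct².
-- If a² + 4bc is a square, θ² = aθ + bc has an integer root ℓ, and evaluation at ℓ sends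
-- solutions in ℤ[θ] to integer solutions; they stay non-trivial because the norm is the product
-- of the evaluations at ℓ and a − ℓ. Integer solutions come back as constants.
-- Otherwise θ ↦ (a + m√D)/2 embeds ℤ[θ] into ℚ(√D), and its image is exactly the set of
-- algebraic integers (s + t√D)/2 with m ∣ t: for those, s² − Dt² is even, because clearing the
-- denominators 2ⁿ of a monic equation of (s + t√D)/2 would otherwise produce an element of odd,
-- hence nonzero, norm; and s² − Dt² even forces s ≡ (t/m) a (mod 2). Non-triviality matches
-- since a nonzero element of ℤ[θ] has nonzero norm when a² + 4bc is not a square.

open import Defs
open import Data.Empty using (⊥-elim)
open import Data.Fin as Fin using (Fin)
open import Data.Integer as ℤ using (ℤ; +_; -[1+_]; _+_; _*_; -_; _-_; ∣_∣; _^_)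
open import Data.Integer.DivMod using (a≡a%n+[a/n]*n; n%d<d)
import Data.Integer.Divisibility.Signed as Signed
open Signed using (divides; ∣ᵤ⇒∣; ∣⇒∣ᵤ)
open import Data.Integer.GCD using (gcd)
import Data.Integer.Properties as ℤP
open import Data.Integer.Tactic.RingSolver using (solve-∀)
open import Data.Nat as ℕ using (ℕ; zero; suc; _>_)
import Data.Nat.Coprimality as Coprime
open Coprime using (coprime-/gcd; coprime-divisor)
import Data.Nat.Divisibility as ℕ∣
open import Data.Nat.DivMod using (m/n*n≡m)
open import Data.Nat.GCD as ℕGCD using (gcd[m,n]∣m; gcd[m,n]∣n; gcd[m,n]≢0; gcd-GCD; module Bézout)
import Data.Nat.Properties as ℕP
open import Algebra.Properties.CommutativeSemigroup ℕP.*-commutativeSemigroup using (interchange; xy∙z≈xz∙y)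
open import Data.Product using (Σ; ∃; ∃₂; _×_; _,_; proj₁; proj₂)
import Data.Rational as ℚ
open import Data.Rational using (ℚ; 0ℚ; 1ℚ; ½)
import Data.Rational.Properties as ℚP
open import Data.Rational.Solver using (module +-*-Solver)
open +-*-Solver using (solve; _:+_; _:*_; _:=_; con)
import Data.Rational.Unnormalised as ℚᵘ
import Data.Rational.Unnormalised.Properties as ℚᵘP
import Data.Sign.Properties as Sign
open import Data.Sum using (_⊎_; inj₁; inj₂; [_,_]′; reduce)
open import Function using (_∘_)
open import Function.Bundles using (_⇔_; mk⇔)
open import Function.Construct.Composition using (_⇔-∘_)
open import Function.Definitions using (Injective)
open import Relation.Binary.PropositionalEquality
open import Relation.Nullary using (¬_; yes; no)

-- Integer arithmetic

Even Odd : ℤ → Set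
Even z = ∃ λ k → z ≡ + 2 * k
Odd  z = ∃ λ k → z ≡ + 2 * k + + 1

parity : ∀ z → Even z ⊎ Odd z
parity z with z ℤ.% + 2 | a≡a%n+[a/n]*n z (+ 2) | n%d<d z (+ 2)
... | 0           | eq | _ = inj₁ (z ℤ./ + 2 , trans eq (lemma (z ℤ./ + 2)))
  where lemma : ∀ q → + 0 + q * + 2 ≡ + 2 * q
        lemma = solve-∀
... | 1           | eq | _ = inj₂ (z ℤ./ + 2 , trans eq (lemma (z ℤ./ + 2)))
  where lemma : ∀ q → + 1 + q * + 2 ≡ + 2 * q + + 1
        lemma = solve-∀
... | suc (suc _) | _  | ℕ.s≤s (ℕ.s≤s ())

even⇒¬odd : ∀ {z} → Even z → ¬ Odd z
even⇒¬odd (p , refl) (q , eq)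
  with ℕP.m*n≡1⇒m≡1 2 ∣ p - q ∣ (trans (sym (ℤP.abs-* (+ 2) (p - q))) (cong ∣_∣ 2[p-q]≡1))
  where 2[p-q]≡1 : + 2 * (p - q) ≡ + 1
        2[p-q]≡1 = ℤP.i-j≡0⇒i≡j _ _ (trans (lemma p q) (ℤP.i≡j⇒i-j≡0 eq))
          where lemma : ∀ p q → + 2 * (p - q) - + 1 ≡ + 2 * p - (+ 2 * q + + 1)
                lemma = solve-∀
... | ()

odd⇒≢0 : ∀ {z} → Odd z → z ≢ + 0
odd⇒≢0 odd refl = even⇒¬odd (+ 0 , refl) odd

odd-* : ∀ {x y} → Odd x → Odd y → Odd (x * y)
odd-* (k , refl) (l , refl) = + 2 * k * l + k + l , lemma k l
  where lemma : ∀ k l → (+ 2 * k + + 1) * (+ 2 * l + + 1) ≡ + 2 * (+ 2 * k * l + k + l) + + 1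
        lemma = solve-∀

odd-+-even : ∀ {x y} → Odd x → Even y → Odd (x + y)
odd-+-even (k , refl) (l , refl) = k + l , lemma k l
  where lemma : ∀ k l → + 2 * k + + 1 + + 2 * l ≡ + 2 * (k + l) + + 1
        lemma = solve-∀

even[x²-y²]⇒even[x-y] : ∀ x y → Even (x * x - y * y) → Even (x - y)
even[x²-y²]⇒even[x-y] x y even with parity (x - y)
... | inj₁ x-y-even = x-y-even
... | inj₂ x-y-odd  = ⊥-elim (even⇒¬odd even (subst Odd (sym (lemma x y)) odd))
  where
  lemma : ∀ x y → x * x - y * y ≡ (x - y) * ((x - y) + + 2 * y)
  lemma = solve-∀
  odd : Odd ((x - y) * ((x - y) + + 2 * y))
  odd = odd-* x-y-odd (odd-+-even x-y-odd (y , refl))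

linear-combination₁ : ∀ {x y l r} k → x - y ≡ k * (l - r) → l ≡ r → x ≡ y
linear-combination₁ {x} {y} {l} k eq refl = ℤP.i-j≡0⇒i≡j x y (trans eq (lemma k l))
  where lemma : ∀ k l → k * (l - l) ≡ + 0
        lemma = solve-∀

linear-combination₂ : ∀ {x y l₁ r₁ l₂ r₂} k₁ k₂ →
  x - y ≡ k₁ * (l₁ - r₁) + k₂ * (l₂ - r₂) → l₁ ≡ r₁ → l₂ ≡ r₂ → x ≡ y
linear-combination₂ {x} {y} {l₁} {_} {l₂} k₁ k₂ eq refl refl =
  ℤP.i-j≡0⇒i≡j x y (trans eq (lemma k₁ k₂ l₁ l₂))
  where lemma : ∀ k₁ k₂ l₁ l₂ → k₁ * (l₁ - l₁) + k₂ * (l₂ - l₂) ≡ + 0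
        lemma = solve-∀

linear-combination₃ : ∀ {x y l₁ r₁ l₂ r₂ l₃ r₃} k₁ k₂ k₃ →
  x - y ≡ k₁ * (l₁ - r₁) + k₂ * (l₂ - r₂) + k₃ * (l₃ - r₃) →
  l₁ ≡ r₁ → l₂ ≡ r₂ → l₃ ≡ r₃ → x ≡ y
linear-combination₃ {x} {y} {l₁} {_} {l₂} {_} {l₃} k₁ k₂ k₃ eq refl refl refl =
  ℤP.i-j≡0⇒i≡j x y (trans eq (lemma k₁ k₂ k₃ l₁ l₂ l₃))
  where lemma : ∀ k₁ k₂ k₃ l₁ l₂ l₃ → k₁ * (l₁ - l₁) + k₂ * (l₂ - l₂) + k₃ * (l₃ - l₃) ≡ + 0
        lemma = solve-∀

∣i∣≡ε*i : ∀ i → ∃ λ ε → + ∣ i ∣ ≡ ε * i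
∣i∣≡ε*i (+ n)    = + 1 , sym (ℤP.*-identityˡ (+ n))
∣i∣≡ε*i -[1+ n ] = - + 1 , sym (ℤP.-1*i≡-i -[1+ n ])

bézout-from-ℕ : ∀ {d} i j x y → d ℕ.+ y ℕ.* ∣ j ∣ ≡ x ℕ.* ∣ i ∣ →
  ∃₂ λ x′ y′ → x′ * i + y′ * j ≡ + d
bézout-from-ℕ {d} i j x y eq with ∣i∣≡ε*i i | ∣i∣≡ε*i j
... | εᵢ , |i|≡ | εⱼ , |j|≡ = + x * εᵢ , - (+ y * εⱼ) ,
  linear-combination₃ (- + 1) (- + x) (+ y) (lemma (+ x) (+ y) (+ d) εᵢ εⱼ i j (+ ∣ i ∣) (+ ∣ j ∣)) eqℤ |i|≡ |j|≡
  where
  eqℤ : + d + + y * + ∣ j ∣ ≡ + x * + ∣ i ∣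
  eqℤ = begin
    + d + + y * + ∣ j ∣       ≡⟨ cong (λ e → + d + e) (ℤP.pos-* y ∣ j ∣) ⟨
    + d + + (y ℕ.* ∣ j ∣)     ≡⟨ ℤP.pos-+ d (y ℕ.* ∣ j ∣) ⟨
    + (d ℕ.+ y ℕ.* ∣ j ∣)     ≡⟨ cong +_ eq ⟩
    + (x ℕ.* ∣ i ∣)           ≡⟨ ℤP.pos-* x ∣ i ∣ ⟩
    + x * + ∣ i ∣             ∎
    where open ≡-Reasoning
  lemma : ∀ x y d εᵢ εⱼ i j I J → x * εᵢ * i + - (y * εⱼ) * j - d
            ≡ - + 1 * ((d + y * J) - x * I) + - x * (I - εᵢ * i) + y * (J - εⱼ * j)
  lemma = solve-∀

bézout : ∀ i j → ∃₂ λ x y → x * i + y * j ≡ gcd i j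
bézout i j with Bézout.identity (gcd-GCD ∣ i ∣ ∣ j ∣)
... | Bézout.+- x y eq = bézout-from-ℕ i j x y eq
... | Bézout.-+ x y eq with bézout-from-ℕ j i y x eq
...   | x′ , y′ , eq′ = y′ , x′ , trans (ℤP.+-comm (y′ * i) (x′ * j)) eq′

bézout₃ : ∀ a b c → gcd (gcd a b) c ≡ + 1 → ∃₂ λ α β → ∃ λ γ → α * a + β * b + γ * c ≡ + 1
bézout₃ a b c gcd≡1 with bézout a b | bézout (gcd a b) c
... | x , y , eq | x′ , y′ , eq′ = x′ * x , x′ * y , y′ , (begin
  x′ * x * a + x′ * y * b + y′ * c ≡⟨ lemma x′ x a y b y′ c ⟩
  x′ * (x * a + y * b) + y′ * c    ≡⟨ cong (λ g → x′ * g + y′ * c) eq ⟩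
  x′ * gcd a b + y′ * c            ≡⟨ eq′ ⟩
  gcd (gcd a b) c                  ≡⟨ gcd≡1 ⟩
  + 1                              ∎)
  where
  open ≡-Reasoning
  lemma : ∀ x′ x a y b y′ c → x′ * x * a + x′ * y * b + y′ * c ≡ x′ * (x * a + y * b) + y′ * c
  lemma = solve-∀

proportional-to-primitive : ∀ {a b c α β γ x y z} → α * a + β * b + γ * c ≡ + 1 →
  a * y ≡ b * x → a * z ≡ c * x → b * z ≡ c * y →
  let t = α * x + β * y + γ * z in x ≡ t * a × y ≡ t * b × z ≡ t * c
proportional-to-primitive {a} {b} {c} {α} {β} {γ} {x} {y} {z} αa+βb+γc≡1 ay≡bx az≡cx bz≡cy =
  linear-combination₃ (- x) (- β) (- γ) (lemmaˣ a b c α β γ x y z) αa+βb+γc≡1 ay≡bx az≡cx ,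
  linear-combination₃ (- y) α (- γ) (lemmaʸ a b c α β γ x y z) αa+βb+γc≡1 ay≡bx bz≡cy ,
  linear-combination₃ (- z) α β (lemmaᶻ a b c α β γ x y z) αa+βb+γc≡1 az≡cx bz≡cy
  where
  lemmaˣ : ∀ a b c α β γ x y z → x - (α * x + β * y + γ * z) * a
             ≡ - x * (α * a + β * b + γ * c - + 1) + - β * (a * y - b * x) + - γ * (a * z - c * x)
  lemmaˣ = solve-∀
  lemmaʸ : ∀ a b c α β γ x y z → y - (α * x + β * y + γ * z) * b
             ≡ - y * (α * a + β * b + γ * c - + 1) + α * (a * y - b * x) + - γ * (b * z - c * y)
  lemmaʸ = solve-∀
  lemmaᶻ : ∀ a b c α β γ x y z → z - (α * x + β * y + γ * z) * c
             ≡ - z * (α * a + β * b + γ * c - + 1) + α * (a * z - c * x) + β * (b * z - c * y)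
  lemmaᶻ = solve-∀

rational-square⇒squareℕ : ∀ x y n .{{_ : ℕ.NonZero y}} → x ℕ.* x ≡ (y ℕ.* y) ℕ.* n → ∃ λ r → n ≡ r ℕ.* r
rational-square⇒squareℕ x y n eq = x′ , n≡x′x′
  where
  open ≡-Reasoning
  g = ℕGCD.gcd x y
  instance
    g≢0 : ℕ.NonZero g
    g≢0 = ℕ.≢-nonZero (gcd[m,n]≢0 x y (inj₂ (ℕ.≢-nonZero⁻¹ y)))
    gg≢0 : ℕ.NonZero (g ℕ.* g)
    gg≢0 = ℕP.m*n≢0 g g
  x′ = x ℕ./ g
  y′ = y ℕ./ g
  reduced : x′ ℕ.* x′ ≡ (y′ ℕ.* y′) ℕ.* n
  reduced = ℕP.*-cancelʳ-≡ _ _ (g ℕ.* g) (begin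
    (x′ ℕ.* x′) ℕ.* (g ℕ.* g)             ≡⟨ interchange x′ x′ g g ⟩
    (x′ ℕ.* g) ℕ.* (x′ ℕ.* g)             ≡⟨ cong₂ ℕ._*_ x′g≡x x′g≡x ⟩
    x ℕ.* x                               ≡⟨ eq ⟩
    (y ℕ.* y) ℕ.* n                       ≡⟨ cong (λ k → (k ℕ.* k) ℕ.* n) y′g≡y ⟨
    ((y′ ℕ.* g) ℕ.* (y′ ℕ.* g)) ℕ.* n     ≡⟨ cong (ℕ._* n) (interchange y′ g y′ g) ⟩
    ((y′ ℕ.* y′) ℕ.* (g ℕ.* g)) ℕ.* n     ≡⟨ xy∙z≈xz∙y (y′ ℕ.* y′) (g ℕ.* g) n ⟩
    ((y′ ℕ.* y′) ℕ.* n) ℕ.* (g ℕ.* g)     ∎)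
    where
    x′g≡x = m/n*n≡m (gcd[m,n]∣m x y)
    y′g≡y = m/n*n≡m (gcd[m,n]∣n x y)
  y′∣x′x′ : y′ ℕ∣.∣ x′ ℕ.* x′
  y′∣x′x′ = ℕ∣.divides (y′ ℕ.* n) (trans reduced (xy∙z≈xz∙y y′ y′ n))
  y′≡1 : y′ ≡ 1
  y′≡1 = coprime-/gcd x y (coprime-divisor (Coprime.sym (coprime-/gcd x y)) y′∣x′x′ , ℕ∣.∣-refl)
  n≡x′x′ : n ≡ x′ ℕ.* x′
  n≡x′x′ = begin
    n                     ≡⟨ ℕP.*-identityˡ n ⟨
    (1 ℕ.* 1) ℕ.* n       ≡⟨ cong (λ k → (k ℕ.* k) ℕ.* n) y′≡1 ⟨
    (y′ ℕ.* y′) ℕ.* n     ≡⟨ reduced ⟨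
    x′ ℕ.* x′             ∎

rational-square⇒square : ∀ X Y Δ → Y ≢ + 0 → X * X ≡ (Y * Y) * Δ → IsSquare Δ
rational-square⇒square X Y Δ Y≢0 eq =
  from-ℕ ∣ X ∣ ∣ Y ∣ Δ (Y≢0 ∘ ℤP.∣i∣≡0⇒i≡0) (trans (sym (square X)) (trans eq (cong (_* Δ) (square Y))))
  where
  square : ∀ Z → Z * Z ≡ + (∣ Z ∣ ℕ.* ∣ Z ∣)
  square Z = trans (cong (ℤ._◃ (∣ Z ∣ ℕ.* ∣ Z ∣)) (Sign.s*s≡+ (ℤ.sign Z))) (ℤP.+◃n≡+n _)
  from-ℕ : ∀ x y Δ → y ≢ 0 → + (x ℕ.* x) ≡ + (y ℕ.* y) * Δ → IsSquare Δ
  from-ℕ x zero    Δ        y≢0 _  = ⊥-elim (y≢0 refl)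
  from-ℕ x (suc y) (+ n)    _   eq
    with rational-square⇒squareℕ x (suc y) n (ℤP.+-injective (trans eq (sym (ℤP.pos-* (suc y ℕ.* suc y) n))))
  ... | r , n≡rr = + r , trans (cong +_ n≡rr) (ℤP.pos-* r r)
  from-ℕ x (suc y) -[1+ n ] _   ()

square-discriminant⇒root : ∀ T N r → T * T + + 4 * N ≡ r * r → ∃ λ ℓ → ℓ * ℓ ≡ T * ℓ + N
square-discriminant⇒root T N r disc≡r² with even[x²-y²]⇒even[x-y] r T (+ 2 * N , r²-T²≡4N)
  where r²-T²≡4N : r * r - T * T ≡ + 2 * (+ 2 * N)
        r²-T²≡4N = linear-combination₁ (- + 1) (lemma T N r) disc≡r²
          where lemma : ∀ T N r → r * r - T * T - + 2 * (+ 2 * N) ≡ - + 1 * (T * T + + 4 * N - r * r)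
                lemma = solve-∀
... | k , r-T≡2k = T + k , ℤP.*-cancelˡ-≡ (+ 4) _ _
  (linear-combination₂ (- (+ 2 * k + r + T)) (- + 1) (lemma T N r k) r-T≡2k disc≡r²)
  where lemma : ∀ T N r k → + 4 * ((T + k) * (T + k)) - + 4 * (T * (T + k) + N)
                  ≡ - (+ 2 * k + r + T) * (r - T - + 2 * k) + - + 1 * (T * T + + 4 * N - r * r)
        lemma = solve-∀

-- Transporting solutions along homomorphisms

-- Only the operations occurring in u xⁱ + v yʲ = w zᵏ; no laws are imposed.
record RawℤAlgebra : Set₁ where
  infixl 6 _+′_
  infixl 7 _*′_ _·′_
  infixr 8 _^′_
  field
    Carrier   : Set
    _+′_ _*′_ : Carrier → Carrier → Carrier
    _·′_      : ℤ → Carrier → Carrier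
    1′        : Carrier
    _^′_      : Carrier → ℕ → Carrier
    ^′-zero   : ∀ x → x ^′ zero ≡ 1′
    ^′-suc    : ∀ x n → x ^′ suc n ≡ x *′ x ^′ n

  Solves : (u v w : ℤ) (i j k : ℕ) → Carrier → Carrier → Carrier → Set
  Solves u v w i j k x y z = u ·′ x ^′ i +′ v ·′ y ^′ j ≡ w ·′ z ^′ k

record Homomorphism (A B : RawℤAlgebra) : Set where
  private
    module A = RawℤAlgebra A
    module B = RawℤAlgebra B
  field
    ⟦_⟧    : A.Carrier → B.Carrier
    +-homo : ∀ x y → ⟦ x A.+′ y ⟧ ≡ ⟦ x ⟧ B.+′ ⟦ y ⟧
    *-homo : ∀ x y → ⟦ x A.*′ y ⟧ ≡ ⟦ x ⟧ B.*′ ⟦ y ⟧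
    ·-homo : ∀ u x → ⟦ u A.·′ x ⟧ ≡ u B.·′ ⟦ x ⟧
    1-homo : ⟦ A.1′ ⟧ ≡ B.1′

  open ≡-Reasoning

  ^-homo : ∀ x n → ⟦ x A.^′ n ⟧ ≡ ⟦ x ⟧ B.^′ n
  ^-homo x zero = begin
    ⟦ x A.^′ zero ⟧  ≡⟨ cong ⟦_⟧ (A.^′-zero x) ⟩
    ⟦ A.1′ ⟧         ≡⟨ 1-homo ⟩
    B.1′             ≡⟨ B.^′-zero ⟦ x ⟧ ⟨
    ⟦ x ⟧ B.^′ zero  ∎
  ^-homo x (suc n) = begin
    ⟦ x A.^′ suc n ⟧         ≡⟨ cong ⟦_⟧ (A.^′-suc x n) ⟩
    ⟦ x A.*′ x A.^′ n ⟧      ≡⟨ *-homo x (x A.^′ n) ⟩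
    ⟦ x ⟧ B.*′ ⟦ x A.^′ n ⟧  ≡⟨ cong (⟦ x ⟧ B.*′_) (^-homo x n) ⟩
    ⟦ x ⟧ B.*′ ⟦ x ⟧ B.^′ n  ≡⟨ B.^′-suc ⟦ x ⟧ n ⟨
    ⟦ x ⟧ B.^′ suc n         ∎

  monomial-homo : ∀ u x n → ⟦ u A.·′ x A.^′ n ⟧ ≡ u B.·′ ⟦ x ⟧ B.^′ n
  monomial-homo u x n = trans (·-homo u (x A.^′ n)) (cong (u B.·′_) (^-homo x n))

  binomial-homo : ∀ u v x y i j →
    ⟦ u A.·′ x A.^′ i A.+′ v A.·′ y A.^′ j ⟧ ≡ u B.·′ ⟦ x ⟧ B.^′ i B.+′ v B.·′ ⟦ y ⟧ B.^′ j
  binomial-homo u v x y i j =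
    trans (+-homo (u A.·′ x A.^′ i) (v A.·′ y A.^′ j)) (cong₂ B._+′_ (monomial-homo u x i) (monomial-homo v y j))

  *³-homo : ∀ x y z → ⟦ x A.*′ y A.*′ z ⟧ ≡ ⟦ x ⟧ B.*′ ⟦ y ⟧ B.*′ ⟦ z ⟧
  *³-homo x y z = trans (*-homo (x A.*′ y) z) (cong (B._*′ ⟦ z ⟧) (*-homo x y))

  solves-homo : ∀ u v w i j k {x y z} → A.Solves u v w i j k x y z → B.Solves u v w i j k ⟦ x ⟧ ⟦ y ⟧ ⟦ z ⟧
  solves-homo u v w i j k {x} {y} {z} eq =
    trans (sym (binomial-homo u v x y i j)) (trans (cong ⟦_⟧ eq) (monomial-homo w z k))

  solves-reflect : Injective _≡_ _≡_ ⟦_⟧ →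
    ∀ u v w i j k {x y z} → B.Solves u v w i j k ⟦ x ⟧ ⟦ y ⟧ ⟦ z ⟧ → A.Solves u v w i j k x y z
  solves-reflect injective u v w i j k {x} {y} {z} eq =
    injective (trans (binomial-homo u v x y i j) (trans eq (sym (monomial-homo w z k))))

ℤ-algebra : RawℤAlgebra
ℤ-algebra = record
  { Carrier = ℤ ; _+′_ = _+_ ; _*′_ = _*_ ; _·′_ = _*_ ; 1′ = + 1 ; _^′_ = _^_
  ; ^′-zero = λ _ → refl ; ^′-suc = λ _ _ → refl }

M₂-algebra : RawℤAlgebra
M₂-algebra = record
  { Carrier = M₂ ; _+′_ = _⊕_ ; _*′_ = _⊗_ ; _·′_ = _·_ ; 1′ = I₂ ; _^′_ = _^ᴹ_
  ; ^′-zero = λ _ → refl ; ^′-suc = λ _ _ → refl }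

K-algebra : ℤ → RawℤAlgebra
K-algebra D = record
  { Carrier = K D ; _+′_ = _+K_ ; _*′_ = _*K_ ; _·′_ = λ u x → ιK u *K x ; 1′ = 1K ; _^′_ = _^K_
  ; ^′-zero = λ _ → refl ; ^′-suc = λ _ _ → refl }

-- The quadratic ring ℤ[θ]

module QuadraticRing (T N : ℤ) where

  -- (s , t) stands for s + tθ, where θ² = Tθ + N
  ℤ[θ] : Set
  ℤ[θ] = ℤ × ℤ

  infixl 6 _+θ_
  infixl 7 _*θ_ _·θ_
  infixr 8 _^θ_

  fromℤ : ℤ → ℤ[θ]
  fromℤ s = s , + 0

  0θ 1θ : ℤ[θ]
  0θ = fromℤ (+ 0)
  1θ = fromℤ (+ 1)

  _+θ_ _*θ_ : ℤ[θ] → ℤ[θ] → ℤ[θ]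
  (s , t) +θ (s′ , t′) = s + s′ , t + t′
  (s , t) *θ (s′ , t′) = s * s′ + N * (t * t′) , s * t′ + t * s′ + T * (t * t′)

  _·θ_ : ℤ → ℤ[θ] → ℤ[θ]
  u ·θ (s , t) = u * s , u * t

  _^θ_ : ℤ[θ] → ℕ → ℤ[θ]
  p ^θ zero  = 1θ
  p ^θ suc n = p *θ p ^θ n

  ℤ[θ]-algebra : RawℤAlgebra
  ℤ[θ]-algebra = record
    { Carrier = ℤ[θ] ; _+′_ = _+θ_ ; _*′_ = _*θ_ ; _·′_ = _·θ_ ; 1′ = 1θ ; _^′_ = _^θ_
    ; ^′-zero = λ _ → refl ; ^′-suc = λ _ _ → refl }

  -- det (s I + t A) when T is the trace of A and N minus its determinant
  norm : ℤ[θ] → ℤ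
  norm (s , t) = s * s + T * s * t - N * (t * t)

  norm-0θ : norm 0θ ≡ + 0
  norm-0θ = lemma T N
    where lemma : ∀ T N → + 0 * + 0 + T * + 0 * + 0 - N * (+ 0 * + 0) ≡ + 0
          lemma = solve-∀

  norm-fromℤ : ∀ s → norm (fromℤ s) ≡ s * s
  norm-fromℤ s = lemma T N s
    where lemma : ∀ T N s → s * s + T * s * + 0 - N * (+ 0 * + 0) ≡ s * s
          lemma = solve-∀

  norm-* : ∀ p q → norm (p *θ q) ≡ norm p * norm q
  norm-* (s , t) (s′ , t′) = lemma T N s t s′ t′
    where lemma : ∀ T N s t s′ t′ →
                    let s″ = s * s′ + N * (t * t′) ; t″ = s * t′ + t * s′ + T * (t * t′) in
                    s″ * s″ + T * s″ * t″ - N * (t″ * t″)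
                    ≡ (s * s + T * s * t - N * (t * t)) * (s′ * s′ + T * s′ * t′ - N * (t′ * t′))
          lemma = solve-∀

  -- 4 norm (s , t) = (2s + tT)² − t² (T² + 4N)
  norm≢0 : ¬ IsSquare (T * T + + 4 * N) → ∀ p → p ≢ 0θ → norm p ≢ + 0
  norm≢0 non-square (s , t) p≢0 norm≡0 with t ℤ.≟ + 0
  ... | yes refl = p≢0 (cong (_, + 0) (reduce (ℤP.i*j≡0⇒i≡0∨j≡0 s (trans (sym (norm-fromℤ s)) norm≡0))))
  ... | no t≢0 = non-square (rational-square⇒square (+ 2 * s + t * T) t (T * T + + 4 * N) t≢0
    (linear-combination₁ (+ 4) (lemma T N s t) norm≡0))
    where lemma : ∀ T N s t → (+ 2 * s + t * T) * (+ 2 * s + t * T) - (t * t) * (T * T + + 4 * N)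
                    ≡ + 4 * (s * s + T * s * t - N * (t * t) - + 0)
          lemma = solve-∀

  Solvable : (u v w : ℤ) (i j k : ℕ) → Set
  Solvable u v w i j k = Σ ℤ[θ] λ p → Σ ℤ[θ] λ q → Σ ℤ[θ] λ r →
    RawℤAlgebra.Solves ℤ[θ]-algebra u v w i j k p q r × norm (p *θ q *θ r) ≢ + 0

  fromℤ-homomorphism : Homomorphism ℤ-algebra ℤ[θ]-algebra
  fromℤ-homomorphism = record
    { ⟦_⟧    = fromℤ
    ; +-homo = λ _ _ → refl
    ; *-homo = λ s s′ → cong₂ _,_ (lemma₁ N s s′) (lemma₂ T s s′)
    ; ·-homo = λ u s → cong (u * s ,_) (sym (ℤP.*-zeroʳ u))
    ; 1-homo = refl
    }
    where
    lemma₁ : ∀ N s s′ → s * s′ ≡ s * s′ + N * (+ 0 * + 0)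
    lemma₁ = solve-∀
    lemma₂ : ∀ T s s′ → + 0 ≡ s * + 0 + + 0 * s′ + T * (+ 0 * + 0)
    lemma₂ = solve-∀

  evaluate : ℤ → ℤ[θ] → ℤ
  evaluate ℓ (s , t) = s + t * ℓ

  evaluate-homomorphism : ∀ ℓ → ℓ * ℓ ≡ T * ℓ + N → Homomorphism ℤ[θ]-algebra ℤ-algebra
  evaluate-homomorphism ℓ root = record
    { ⟦_⟧    = evaluate ℓ
    ; +-homo = λ { (s , t) (s′ , t′) → lemma₁ ℓ s t s′ t′ }
    ; *-homo = λ { (s , t) (s′ , t′) → linear-combination₁ (- (t * t′)) (lemma₂ T N ℓ s t s′ t′) root }
    ; ·-homo = λ { u (s , t) → lemma₃ ℓ u s t }
    ; 1-homo = refl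
    }
    where
    lemma₁ : ∀ ℓ s t s′ t′ → s + s′ + (t + t′) * ℓ ≡ s + t * ℓ + (s′ + t′ * ℓ)
    lemma₁ = solve-∀
    lemma₂ : ∀ T N ℓ s t s′ t′ →
      s * s′ + N * (t * t′) + (s * t′ + t * s′ + T * (t * t′)) * ℓ - (s + t * ℓ) * (s′ + t′ * ℓ)
      ≡ - (t * t′) * (ℓ * ℓ - (T * ℓ + N))
    lemma₂ = solve-∀
    lemma₃ : ∀ ℓ u s t → u * s + u * t * ℓ ≡ u * (s + t * ℓ)
    lemma₃ = solve-∀

  norm≡product-of-evaluations : ∀ ℓ → ℓ * ℓ ≡ T * ℓ + N → ∀ p → norm p ≡ evaluate ℓ p * evaluate (T - ℓ) p
  norm≡product-of-evaluations ℓ root (s , t) = linear-combination₁ (t * t) (lemma T N ℓ s t) root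
    where lemma : ∀ T N ℓ s t → s * s + T * s * t - N * (t * t) - (s + t * ℓ) * (s + t * (T - ℓ))
                    ≡ t * t * (ℓ * ℓ - (T * ℓ + N))
          lemma = solve-∀

  Solvable⇔IntEqSolvable : ∀ ℓ → ℓ * ℓ ≡ T * ℓ + N → ∀ u v w i j k →
    Solvable u v w i j k ⇔ IntEqSolvable u v w i j k
  Solvable⇔IntEqSolvable ℓ root u v w i j k = mk⇔ to from
    where
    module E = Homomorphism (evaluate-homomorphism ℓ root)
    module F = Homomorphism fromℤ-homomorphism
    to : Solvable u v w i j k → IntEqSolvable u v w i j k
    to (p , q , r , eq , norm≢0) =
      evaluate ℓ p , evaluate ℓ q , evaluate ℓ r , E.solves-homo u v w i j k eq ,
      λ xyz≡0 → norm≢0 (begin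
        norm pqr                               ≡⟨ norm≡product-of-evaluations ℓ root pqr ⟩
        evaluate ℓ pqr * evaluate (T - ℓ) pqr  ≡⟨ cong (_* evaluate (T - ℓ) pqr) (trans (E.*³-homo p q r) xyz≡0) ⟩
        + 0 * evaluate (T - ℓ) pqr             ≡⟨⟩
        + 0                                    ∎)
      where
      open ≡-Reasoning
      pqr = p *θ q *θ r
    from : IntEqSolvable u v w i j k → Solvable u v w i j k
    from (x , y , z , eq , xyz≢0) =
      fromℤ x , fromℤ y , fromℤ z , F.solves-homo u v w i j k eq ,
      λ norm≡0 → [ xyz≢0 , xyz≢0 ]′ (ℤP.i*j≡0⇒i≡0∨j≡0 (x * y * z)
        (trans (sym (norm-fromℤ (x * y * z))) (trans (cong norm (F.*³-homo x y z)) norm≡0)))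

  odd-norm-shift : ∀ e z → Odd (norm z) → Odd (norm (fromℤ (+ 2 * e) +θ z))
  odd-norm-shift e (s , t) odd =
    subst Odd (sym (lemma T N e s t)) (odd-+-even odd (+ 2 * e * e + + 2 * e * s + e * T * t , refl))
    where lemma : ∀ T N e s t → let s′ = + 2 * e + s ; t′ = + 0 + t in
                    s′ * s′ + T * s′ * t′ - N * (t′ * t′)
                    ≡ (s * s + T * s * t - N * (t * t)) + + 2 * (+ 2 * e * e + + 2 * e * s + e * T * t)
          lemma = solve-∀

  -- horner n c y = 2ⁿ f(y / 2) for f = Xⁿ + Σₗ c l Xˡ, computed in the Horner shape of polySum
  horner : (n : ℕ) → (Fin n → ℤ) → ℤ[θ] → ℤ[θ]
  horner zero    c y = 1θ
  horner (suc n) c y = fromℤ ((+ 2) ^ suc n * c Fin.zero) +θ y *θ horner n (c ∘ Fin.suc) y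

  -- all coefficients of 2ⁿ f(X / 2) but the leading one are even
  odd-norm-horner : ∀ n c y → Odd (norm y) → Odd (norm (horner n c y))
  odd-norm-horner zero    c y _   = + 0 , lemma T N
    where lemma : ∀ T N → + 1 * + 1 + T * + 1 * + 0 - N * (+ 0 * + 0) ≡ + 2 * + 0 + + 1
          lemma = solve-∀
  odd-norm-horner (suc n) c y odd =
    subst (λ e → Odd (norm (fromℤ e +θ y *θ h))) (sym (ℤP.*-assoc (+ 2) ((+ 2) ^ n) (c Fin.zero)))
      (odd-norm-shift ((+ 2) ^ n * c Fin.zero) (y *θ h)
        (subst Odd (sym (norm-* y h)) (odd-* odd (odd-norm-horner n (c ∘ Fin.suc) y odd))))
    where h = horner n (c ∘ Fin.suc) y

  horner≢0θ : ∀ n c y → Odd (norm y) → horner n c y ≢ 0θ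
  horner≢0θ n c y odd eq = odd⇒≢0 (odd-norm-horner n c y odd) (trans (cong norm eq) norm-0θ)

-- ℚ(√D)

ι : ℤ → ℚ
ι n = n ℚ./ 1

ι-toℚᵘ : ∀ n → ℚ.toℚᵘ (ι n) ℚᵘ.≃ ℚᵘ.mkℚᵘ n 0
ι-toℚᵘ n = ℚP.toℚᵘ-fromℚᵘ (ℚᵘ.mkℚᵘ n 0)

ι-+ : ∀ m n → ι (m + n) ≡ ι m ℚ.+ ι n
ι-+ m n = ℚP.toℚᵘ-injective (ℚᵘP.≃-trans (ι-toℚᵘ (m + n)) (ℚᵘP.≃-trans (ℚᵘ.*≡* (lemma m n))
  (ℚᵘP.≃-sym (ℚᵘP.≃-trans (ℚP.toℚᵘ-homo-+ (ι m) (ι n)) (ℚᵘP.+-cong (ι-toℚᵘ m) (ι-toℚᵘ n))))))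
  where lemma : ∀ m n → (m + n) * + 1 ≡ (m * + 1 + n * + 1) * + 1
        lemma = solve-∀

ι-* : ∀ m n → ι (m * n) ≡ ι m ℚ.* ι n
ι-* m n = ℚP.toℚᵘ-injective (ℚᵘP.≃-trans (ι-toℚᵘ (m * n)) (ℚᵘP.≃-trans (ℚᵘ.*≡* refl)
  (ℚᵘP.≃-sym (ℚᵘP.≃-trans (ℚP.toℚᵘ-homo-* (ι m) (ι n)) (ℚᵘP.*-cong (ι-toℚᵘ m) (ι-toℚᵘ n))))))

ι-injective : ∀ {m n} → ι m ≡ ι n → m ≡ n
ι-injective {m} {n} eq with ℚᵘP.≃-trans (ℚᵘP.≃-sym (ι-toℚᵘ m)) (ℚᵘP.≃-trans (ℚP.toℚᵘ-cong eq) (ι-toℚᵘ n))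
... | ℚᵘ.*≡* m*1≡n*1 = trans (sym (ℤP.*-identityʳ m)) (trans m*1≡n*1 (ℤP.*-identityʳ n))

/2≡ι*½ : ∀ s → s ℚ./ 2 ≡ ι s ℚ.* ½
/2≡ι*½ s = ℚP.toℚᵘ-injective (ℚᵘP.≃-trans (ℚP.toℚᵘ-fromℚᵘ (ℚᵘ.mkℚᵘ s 1)) (ℚᵘP.≃-trans (ℚᵘ.*≡* (lemma s))
  (ℚᵘP.≃-sym (ℚᵘP.≃-trans (ℚP.toℚᵘ-homo-* (ι s) ½)
    (ℚᵘP.*-cong (ι-toℚᵘ s) (ℚP.toℚᵘ-fromℚᵘ (ℚᵘ.mkℚᵘ (+ 1) 1)))))))
  where lemma : ∀ s → s * + 2 ≡ (s * + 1) * + 2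
        lemma = solve-∀

½^ : ℕ → ℚ
½^ zero    = 1ℚ
½^ (suc j) = ½ ℚ.* ½^ j

½^-+ : ∀ j l → ½^ (j ℕ.+ l) ≡ ½^ j ℚ.* ½^ l
½^-+ zero    l = sym (ℚP.*-identityˡ (½^ l))
½^-+ (suc j) l = trans (cong (½ ℚ.*_) (½^-+ j l)) (sym (ℚP.*-assoc ½ (½^ j) (½^ l)))

*½^-cancel : ∀ j {x y} → x ℚ.* ½^ j ≡ y ℚ.* ½^ j → x ≡ y
*½^-cancel zero    {x} {y} eq = trans (sym (ℚP.*-identityʳ x)) (trans eq (ℚP.*-identityʳ y))
*½^-cancel (suc j) {x} {y} eq = *½^-cancel j (begin
  x ℚ.* ½^ j                        ≡⟨ double-half x ⟨
  (x ℚ.* (½ ℚ.* ½^ j)) ℚ.* ι (+ 2)  ≡⟨ cong (ℚ._* ι (+ 2)) eq ⟩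
  (y ℚ.* (½ ℚ.* ½^ j)) ℚ.* ι (+ 2)  ≡⟨ double-half y ⟩
  y ℚ.* ½^ j                        ∎)
  where
  open ≡-Reasoning
  double-half : ∀ x → (x ℚ.* (½ ℚ.* ½^ j)) ℚ.* ι (+ 2) ≡ x ℚ.* ½^ j
  double-half x = trans (lemma x ½ (½^ j) (ι (+ 2))) (ℚP.*-identityʳ (x ℚ.* ½^ j))
    where lemma : ∀ x a h b → (x ℚ.* (a ℚ.* h)) ℚ.* b ≡ (x ℚ.* h) ℚ.* (a ℚ.* b)
          lemma = solve 4 (λ x a h b → (x :* (a :* h)) :* b := (x :* h) :* (a :* b)) refl

K-≡ : ∀ {D} {p q p′ q′ : ℚ} → p ≡ p′ → q ≡ q′ → _≡_ {A = K D} (p +√ q) (p′ +√ q′)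
K-≡ refl refl = refl

module HalvedEmbedding (D : ℤ) where
  open QuadraticRing (+ 0) D
  open ≡-Reasoning

  emb : ℕ → ℤ[θ] → K D
  emb j (s , t) = (ι s ℚ.* ½^ j) +√ (ι t ℚ.* ½^ j)

  emb-1 : ∀ s t → emb 1 (s , t) ≡ (s ℚ./ 2) +√ (t ℚ./ 2)
  emb-1 s t = K-≡ (halve s) (halve t)
    where halve : ∀ s → ι s ℚ.* (½ ℚ.* 1ℚ) ≡ s ℚ./ 2
          halve s = trans (cong (ι s ℚ.*_) (ℚP.*-identityʳ ½)) (sym (/2≡ι*½ s))

  emb-0θ : ∀ j → emb j 0θ ≡ 0K
  emb-0θ j = K-≡ (ℚP.*-zeroˡ (½^ j)) (ℚP.*-zeroˡ (½^ j))

  emb-ιK : ∀ c → emb 0 (fromℤ c) ≡ ιK c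
  emb-ιK c = K-≡ (ℚP.*-identityʳ (ι c)) refl

  emb-injective : ∀ j {y z} → emb j y ≡ emb j z → y ≡ z
  emb-injective j eq = cong₂ _,_ (ι-injective (*½^-cancel j (cong re eq))) (ι-injective (*½^-cancel j (cong im eq)))

  emb-+ : ∀ j y z → emb j (y +θ z) ≡ emb j y +K emb j z
  emb-+ j (s , t) (s′ , t′) = K-≡ (distrib s s′) (distrib t t′)
    where distrib : ∀ a b → ι (a + b) ℚ.* ½^ j ≡ ι a ℚ.* ½^ j ℚ.+ ι b ℚ.* ½^ j
          distrib a b = trans (cong (ℚ._* ½^ j) (ι-+ a b)) (ℚP.*-distribʳ-+ (½^ j) (ι a) (ι b))

  emb-* : ∀ j l y z → emb (j ℕ.+ l) (y *θ z) ≡ emb j y *K emb l z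
  emb-* j l (s , t) (s′ , t′) = K-≡
    (trans (cong₂ ℚ._*_ ι-re (½^-+ j l)) (lemmaʳ (ι s) (ι s′) (ι D) (ι t) (ι t′) (½^ j) (½^ l)))
    (trans (cong₂ ℚ._*_ ι-im (½^-+ j l)) (lemmaⁱ (ι s) (ι s′) (ι t) (ι t′) (½^ j) (½^ l)))
    where
    ι-re : ι (s * s′ + D * (t * t′)) ≡ ι s ℚ.* ι s′ ℚ.+ ι D ℚ.* (ι t ℚ.* ι t′)
    ι-re = trans (ι-+ (s * s′) (D * (t * t′)))
                 (cong₂ ℚ._+_ (ι-* s s′) (trans (ι-* D (t * t′)) (cong (ι D ℚ.*_) (ι-* t t′))))
    ι-im : ι (s * t′ + t * s′ + + 0) ≡ ι s ℚ.* ι t′ ℚ.+ ι t ℚ.* ι s′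
    ι-im = trans (cong ι (ℤP.+-identityʳ (s * t′ + t * s′)))
                 (trans (ι-+ (s * t′) (t * s′)) (cong₂ ℚ._+_ (ι-* s t′) (ι-* t s′)))
    lemmaʳ : ∀ s s′ d t t′ h k → (s ℚ.* s′ ℚ.+ d ℚ.* (t ℚ.* t′)) ℚ.* (h ℚ.* k)
               ≡ (s ℚ.* h) ℚ.* (s′ ℚ.* k) ℚ.+ d ℚ.* ((t ℚ.* h) ℚ.* (t′ ℚ.* k))
    lemmaʳ = solve 7 (λ s s′ d t t′ h k → (s :* s′ :+ d :* (t :* t′)) :* (h :* k)
                        := (s :* h) :* (s′ :* k) :+ d :* ((t :* h) :* (t′ :* k))) refl
    lemmaⁱ : ∀ s s′ t t′ h k → (s ℚ.* t′ ℚ.+ t ℚ.* s′) ℚ.* (h ℚ.* k)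
               ≡ (s ℚ.* h) ℚ.* (t′ ℚ.* k) ℚ.+ (t ℚ.* h) ℚ.* (s′ ℚ.* k)
    lemmaⁱ = solve 6 (λ s s′ t t′ h k → (s :* t′ :+ t :* s′) :* (h :* k)
                        := (s :* h) :* (t′ :* k) :+ (t :* h) :* (s′ :* k)) refl

  emb-2· : ∀ j y → emb (suc j) (+ 2 ·θ y) ≡ emb j y
  emb-2· j (s , t) = K-≡ (halve s) (halve t)
    where halve : ∀ a → ι (+ 2 * a) ℚ.* (½ ℚ.* ½^ j) ≡ ι a ℚ.* ½^ j
          halve a = begin
            ι (+ 2 * a) ℚ.* (½ ℚ.* ½^ j)         ≡⟨ cong (ℚ._* (½ ℚ.* ½^ j)) (ι-* (+ 2) a) ⟩
            (ι (+ 2) ℚ.* ι a) ℚ.* (½ ℚ.* ½^ j)   ≡⟨ lemma (ι (+ 2)) (ι a) ½ (½^ j) ⟩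
            (ι (+ 2) ℚ.* ½) ℚ.* (ι a ℚ.* ½^ j)   ≡⟨ ℚP.*-identityˡ (ι a ℚ.* ½^ j) ⟩
            ι a ℚ.* ½^ j                         ∎
            where lemma : ∀ b a h k → (b ℚ.* a) ℚ.* (h ℚ.* k) ≡ (b ℚ.* h) ℚ.* (a ℚ.* k)
                  lemma = solve 4 (λ b a h k → (b :* a) :* (h :* k) := (b :* h) :* (a :* k)) refl

  emb-2^*c : ∀ j c → emb j (fromℤ ((+ 2) ^ j * c)) ≡ ιK c
  emb-2^*c zero    c = trans (cong (λ e → emb 0 (fromℤ e)) (ℤP.*-identityˡ c)) (emb-ιK c)
  emb-2^*c (suc j) c = trans (cong (λ e → emb (suc j) (fromℤ e)) (ℤP.*-assoc (+ 2) ((+ 2) ^ j) c))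
                             (trans (emb-2· j (fromℤ ((+ 2) ^ j * c))) (emb-2^*c j c))

  monic-step : ∀ n c (x : K D) →
    ιK (c Fin.zero) +K (x *K ((x ^K n) +K polySum n (c ∘ Fin.suc) x)) ≡ (x ^K suc n) +K polySum (suc n) c x
  monic-step n c x = rearrange (ι (c Fin.zero)) x (x ^K n) (polySum n (c ∘ Fin.suc) x)
    where
    rearrange : ∀ c (x X P : K D) →
      (c +√ 0ℚ) +K (x *K (X +K P)) ≡ (x *K X) +K (((c +√ 0ℚ) *K 1K) +K (x *K P))
    rearrange c (x₁ +√ x₂) (X₁ +√ X₂) (P₁ +√ P₂) =
      K-≡ (lemmaʳ c (ι D) x₁ x₂ X₁ X₂ P₁ P₂) (lemmaⁱ c x₁ x₂ X₁ X₂ P₁ P₂)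
      where
      lemmaʳ : ∀ c d x₁ x₂ X₁ X₂ P₁ P₂ →
        c ℚ.+ (x₁ ℚ.* (X₁ ℚ.+ P₁) ℚ.+ d ℚ.* (x₂ ℚ.* (X₂ ℚ.+ P₂)))
        ≡ (x₁ ℚ.* X₁ ℚ.+ d ℚ.* (x₂ ℚ.* X₂))
          ℚ.+ ((c ℚ.* 1ℚ ℚ.+ d ℚ.* (0ℚ ℚ.* 0ℚ)) ℚ.+ (x₁ ℚ.* P₁ ℚ.+ d ℚ.* (x₂ ℚ.* P₂)))
      lemmaʳ = solve 8 (λ c d x₁ x₂ X₁ X₂ P₁ P₂ →
        c :+ (x₁ :* (X₁ :+ P₁) :+ d :* (x₂ :* (X₂ :+ P₂)))
        := (x₁ :* X₁ :+ d :* (x₂ :* X₂))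
           :+ ((c :* con 1ℚ :+ d :* (con 0ℚ :* con 0ℚ)) :+ (x₁ :* P₁ :+ d :* (x₂ :* P₂)))) refl
      lemmaⁱ : ∀ c x₁ x₂ X₁ X₂ P₁ P₂ →
        0ℚ ℚ.+ (x₁ ℚ.* (X₂ ℚ.+ P₂) ℚ.+ x₂ ℚ.* (X₁ ℚ.+ P₁))
        ≡ (x₁ ℚ.* X₂ ℚ.+ x₂ ℚ.* X₁) ℚ.+ ((c ℚ.* 0ℚ ℚ.+ 0ℚ ℚ.* 1ℚ) ℚ.+ (x₁ ℚ.* P₂ ℚ.+ x₂ ℚ.* P₁))
      lemmaⁱ = solve 7 (λ c x₁ x₂ X₁ X₂ P₁ P₂ →
        con 0ℚ :+ (x₁ :* (X₂ :+ P₂) :+ x₂ :* (X₁ :+ P₁))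
        := (x₁ :* X₂ :+ x₂ :* X₁) :+ ((c :* con 0ℚ :+ con 0ℚ :* con 1ℚ) :+ (x₁ :* P₂ :+ x₂ :* P₁))) refl

  emb-horner : ∀ n c y → emb n (horner n c y) ≡ (emb 1 y ^K n) +K polySum n c (emb 1 y)
  emb-horner zero    c y = refl
  emb-horner (suc n) c y = begin
    emb (suc n) (fromℤ ((+ 2) ^ suc n * c Fin.zero) +θ y *θ horner n c′ y)
      ≡⟨ emb-+ (suc n) (fromℤ ((+ 2) ^ suc n * c Fin.zero)) (y *θ horner n c′ y) ⟩
    emb (suc n) (fromℤ ((+ 2) ^ suc n * c Fin.zero)) +K emb (suc n) (y *θ horner n c′ y)
      ≡⟨ cong₂ _+K_ (emb-2^*c (suc n) (c Fin.zero)) (emb-* 1 n y (horner n c′ y)) ⟩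
    ιK (c Fin.zero) +K (x *K emb n (horner n c′ y))
      ≡⟨ cong (λ e → ιK (c Fin.zero) +K (x *K e)) (emb-horner n c′ y) ⟩
    ιK (c Fin.zero) +K (x *K ((x ^K n) +K polySum n c′ x))
      ≡⟨ monic-step n c x ⟩
    (x ^K suc n) +K polySum (suc n) c x ∎
    where
    x = emb 1 y
    c′ = c ∘ Fin.suc

  integral-half⇒even-norm : ∀ y → IsAlgebraicInteger D (emb 1 y) → Even (norm y)
  integral-half⇒even-norm y (n , c , root) with parity (norm y)
  ... | inj₁ even = even
  ... | inj₂ odd  = ⊥-elim (horner≢0θ (suc n) c y odd
          (emb-injective (suc n) (trans (emb-horner (suc n) c y) (trans root (sym (emb-0θ (suc n)))))))

-- The centraliser of A

mat-≡ : ∀ {a b c d a′ b′ c′ d′} → a ≡ a′ → b ≡ b′ → c ≡ c′ → d ≡ d′ → mat a b c d ≡ mat a′ b′ c′ d′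
mat-≡ refl refl refl refl = refl

module Centraliser (a b c : ℤ) where
  open QuadraticRing a (b * c)

  A : M₂
  A = mat a b c (+ 0)

  asMatrix : ℤ[θ] → M₂
  asMatrix (s , t) = mat (s + t * a) (t * b) (t * c) s

  asMatrix-homomorphism : Homomorphism ℤ[θ]-algebra M₂-algebra
  asMatrix-homomorphism = record
    { ⟦_⟧    = asMatrix
    ; +-homo = λ { (s , t) (s′ , t′) → mat-≡ (lemma₁ a s t s′ t′) (lemma₂ b t t′) (lemma₂ c t t′) refl }
    ; *-homo = λ { (s , t) (s′ , t′) →
        mat-≡ (lemma₃ a b c s t s′ t′) (lemma₄ a b s t s′ t′) (lemma₅ a c s t s′ t′) (lemma₆ b c s t s′ t′) }
    ; ·-homo = λ { u (s , t) → mat-≡ (lemma₇ a u s t) (lemma₈ b u t) (lemma₈ c u t) refl }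
    ; 1-homo = mat-≡ (ℤP.+-identityʳ (+ 1)) refl refl refl
    }
    where
    lemma₁ : ∀ a s t s′ t′ → s + s′ + (t + t′) * a ≡ s + t * a + (s′ + t′ * a)
    lemma₁ = solve-∀
    lemma₂ : ∀ b t t′ → (t + t′) * b ≡ t * b + t′ * b
    lemma₂ = solve-∀
    lemma₃ : ∀ a b c s t s′ t′ → s * s′ + b * c * (t * t′) + (s * t′ + t * s′ + a * (t * t′)) * a
               ≡ (s + t * a) * (s′ + t′ * a) + (t * b) * (t′ * c)
    lemma₃ = solve-∀
    lemma₄ : ∀ a b s t s′ t′ → (s * t′ + t * s′ + a * (t * t′)) * b ≡ (s + t * a) * (t′ * b) + (t * b) * s′
    lemma₄ = solve-∀
    lemma₅ : ∀ a c s t s′ t′ → (s * t′ + t * s′ + a * (t * t′)) * c ≡ (t * c) * (s′ + t′ * a) + s * (t′ * c)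
    lemma₅ = solve-∀
    lemma₆ : ∀ b c s t s′ t′ → s * s′ + b * c * (t * t′) ≡ (t * c) * (t′ * b) + s * s′
    lemma₆ = solve-∀
    lemma₇ : ∀ a u s t → u * s + u * t * a ≡ u * (s + t * a)
    lemma₇ = solve-∀
    lemma₈ : ∀ b u t → u * t * b ≡ u * (t * b)
    lemma₈ = solve-∀

  open Homomorphism asMatrix-homomorphism using (solves-homo; solves-reflect; *³-homo)

  asMatrix∈C : ∀ p → asMatrix p ∈C A
  asMatrix∈C (s , t) = mat-≡ (lemma₁ a b c s t) (lemma₂ a b s t) (lemma₃ a c s t) (lemma₄ b c s t)
    where
    lemma₁ : ∀ a b c s t → a * (s + t * a) + b * (t * c) ≡ (s + t * a) * a + (t * b) * c
    lemma₁ = solve-∀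
    lemma₂ : ∀ a b s t → a * (t * b) + b * s ≡ (s + t * a) * b + (t * b) * + 0
    lemma₂ = solve-∀
    lemma₃ : ∀ a c s t → c * (s + t * a) + + 0 * (t * c) ≡ (t * c) * a + s * c
    lemma₃ = solve-∀
    lemma₄ : ∀ b c s t → c * (t * b) + + 0 * s ≡ (t * c) * b + s * + 0
    lemma₄ = solve-∀

  asMatrix-injective : b ≢ + 0 → Injective _≡_ _≡_ asMatrix
  asMatrix-injective b≢0 {s , t} {s′ , t′} eq =
    cong₂ _,_ (cong e₂₂ eq) (ℤP.*-cancelʳ-≡ t t′ b {{ℤ.≢-nonZero b≢0}} (cong e₁₂ eq))

  det-asMatrix : ∀ p → det (asMatrix p) ≡ norm p
  det-asMatrix (s , t) = lemma a b c s t
    where lemma : ∀ a b c s t → (s + t * a) * s - (t * b) * (t * c) ≡ s * s + a * s * t - b * c * (t * t)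
          lemma = solve-∀

  commutes⇒minors : ∀ {P Q R S} → mat P Q R S ∈C A →
    a * Q ≡ b * (P - S) × a * R ≡ c * (P - S) × b * R ≡ c * Q
  commutes⇒minors {P} {Q} {R} {S} AX≡XA =
    linear-combination₁ (+ 1) (lemma₁ a b P Q S) (cong e₁₂ AX≡XA) ,
    linear-combination₁ (- + 1) (lemma₂ a c P R S) (cong e₂₁ AX≡XA) ,
    linear-combination₁ (+ 1) (lemma₃ a b c P Q R) (cong e₁₁ AX≡XA)
    where
    lemma₁ : ∀ a b P Q S → a * Q - b * (P - S) ≡ + 1 * ((a * Q + b * S) - (P * b + Q * + 0))
    lemma₁ = solve-∀
    lemma₂ : ∀ a c P R S → a * R - c * (P - S) ≡ - + 1 * ((c * P + + 0 * R) - (R * a + S * c))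
    lemma₂ = solve-∀
    lemma₃ : ∀ a b c P Q R → b * R - c * Q ≡ + 1 * ((a * P + b * R) - (P * a + Q * c))
    lemma₃ = solve-∀

  centraliser⊆image : gcd (gcd a b) c ≡ + 1 → ∀ X → X ∈C A → ∃ λ p → X ≡ asMatrix p
  centraliser⊆image gcd≡1 (mat P Q R S) AX≡XA = from-bézout (bézout₃ a b c gcd≡1) (commutes⇒minors AX≡XA)
    where
    from-bézout : (∃₂ λ α β → ∃ λ γ → α * a + β * b + γ * c ≡ + 1) →
      a * Q ≡ b * (P - S) × a * R ≡ c * (P - S) × b * R ≡ c * Q → ∃ λ p → mat P Q R S ≡ asMatrix p
    from-bézout (α , β , γ , αa+βb+γc≡1) (aQ≡b[P-S] , aR≡c[P-S] , bR≡cQ) =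
      (S , t) , mat-≡ P≡S+ta (proj₁ (proj₂ proportional)) (proj₂ (proj₂ proportional)) refl
      where
      t = α * (P - S) + β * Q + γ * R
      proportional : P - S ≡ t * a × Q ≡ t * b × R ≡ t * c
      proportional = proportional-to-primitive {a} {b} {c} {α} {β} {γ} {P - S} {Q} {R}
        αa+βb+γc≡1 aQ≡b[P-S] aR≡c[P-S] bR≡cQ
      P≡S+ta : P ≡ S + t * a
      P≡S+ta = linear-combination₁ (+ 1) (lemma P S (t * a)) (proj₁ proportional)
        where lemma : ∀ P S x → P - (S + x) ≡ + 1 * ((P - S) - x)
              lemma = solve-∀

  MatrixEqSolvable⇔Solvable : b ≢ + 0 → gcd (gcd a b) c ≡ + 1 → ∀ u v w i j k →
    MatrixEqSolvable A u v w i j k ⇔ Solvable u v w i j k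
  MatrixEqSolvable⇔Solvable b≢0 gcd≡1 u v w i j k = mk⇔ to from
    where
    to : MatrixEqSolvable A u v w i j k → Solvable u v w i j k
    to (X , Y , Z , X∈C , Y∈C , Z∈C , eq , det≢0) =
      from-image (centraliser⊆image gcd≡1 X X∈C) (centraliser⊆image gcd≡1 Y Y∈C) (centraliser⊆image gcd≡1 Z Z∈C)
                 eq det≢0
      where
      from-image : ∀ {X Y Z} → (∃ λ p → X ≡ asMatrix p) → (∃ λ q → Y ≡ asMatrix q) → (∃ λ r → Z ≡ asMatrix r) →
        RawℤAlgebra.Solves M₂-algebra u v w i j k X Y Z → det (X ⊗ Y ⊗ Z) ≢ + 0 → Solvable u v w i j k
      from-image (p , refl) (q , refl) (r , refl) eq det≢0 =
        p , q , r , solves-reflect (asMatrix-injective b≢0) u v w i j k eq ,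
        λ norm≡0 → det≢0 (trans (cong det (sym (*³-homo p q r))) (trans (det-asMatrix (p *θ q *θ r)) norm≡0))
    from : Solvable u v w i j k → MatrixEqSolvable A u v w i j k
    from (p , q , r , eq , norm≢0) =
      asMatrix p , asMatrix q , asMatrix r , asMatrix∈C p , asMatrix∈C q , asMatrix∈C r ,
      solves-homo u v w i j k eq ,
      λ det≡0 → norm≢0 (trans (sym (det-asMatrix (p *θ q *θ r))) (trans (cong det (*³-homo p q r)) det≡0))

-- The non-split case

module NonSplitCase (T N D : ℤ) (m : ℕ) (disc : T * T + + 4 * N ≡ (+ m * + m) * D) where
  open QuadraticRing T N
  module √D = QuadraticRing (+ 0) D
  open HalvedEmbedding D
  open ≡-Reasoning

  -- 2 (s + tθ) = (2s + tT) + tm √D, as θ = (T + m √D) / 2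
  double : ℤ[θ] → √D.ℤ[θ]
  double (s , t) = + 2 * s + t * T , t * + m

  double-+ : ∀ p q → double (p +θ q) ≡ double p √D.+θ double q
  double-+ (s , t) (s′ , t′) = cong₂ _,_ (lemma₁ T s t s′ t′) (lemma₂ (+ m) t t′)
    where
    lemma₁ : ∀ T s t s′ t′ → + 2 * (s + s′) + (t + t′) * T ≡ + 2 * s + t * T + (+ 2 * s′ + t′ * T)
    lemma₁ = solve-∀
    lemma₂ : ∀ m t t′ → (t + t′) * m ≡ t * m + t′ * m
    lemma₂ = solve-∀

  double-* : ∀ p q → double p √D.*θ double q ≡ + 2 √D.·θ double (p *θ q)
  double-* (s , t) (s′ , t′) = cong₂ _,_
    (linear-combination₁ (- (t * t′)) (lemma₁ T N D (+ m) s t s′ t′) disc)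
    (lemma₂ T N (+ m) s t s′ t′)
    where
    lemma₁ : ∀ T N D m s t s′ t′ →
      (+ 2 * s + t * T) * (+ 2 * s′ + t′ * T) + D * ((t * m) * (t′ * m))
        - + 2 * (+ 2 * (s * s′ + N * (t * t′)) + (s * t′ + t * s′ + T * (t * t′)) * T)
      ≡ - (t * t′) * (T * T + + 4 * N - (m * m) * D)
    lemma₁ = solve-∀
    lemma₂ : ∀ T N m s t s′ t′ →
      (+ 2 * s + t * T) * (t′ * m) + (t * m) * (+ 2 * s′ + t′ * T) + + 0 * ((t * m) * (t′ * m))
      ≡ + 2 * ((s * t′ + t * s′ + T * (t * t′)) * m)
    lemma₂ = solve-∀

  double-· : ∀ u p → √D.fromℤ u √D.*θ double p ≡ double (u ·θ p)
  double-· u (s , t) = cong₂ _,_ (lemma₁ T D (+ m) u s t) (lemma₂ T (+ m) u s t)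
    where
    lemma₁ : ∀ T D m u s t → u * (+ 2 * s + t * T) + D * (+ 0 * (t * m)) ≡ + 2 * (u * s) + u * t * T
    lemma₁ = solve-∀
    lemma₂ : ∀ T m u s t → u * (t * m) + + 0 * (+ 2 * s + t * T) + + 0 * (+ 0 * (t * m)) ≡ u * t * m
    lemma₂ = solve-∀

  norm-double : ∀ p → √D.norm (double p) ≡ + 4 * norm p
  norm-double (s , t) = linear-combination₁ (t * t) (lemma T N D (+ m) s t) disc
    where lemma : ∀ T N D m s t →
            (+ 2 * s + t * T) * (+ 2 * s + t * T) + + 0 * (+ 2 * s + t * T) * (t * m) - D * ((t * m) * (t * m))
              - + 4 * (s * s + T * s * t - N * (t * t))
            ≡ t * t * (T * T + + 4 * N - (m * m) * D)
          lemma = solve-∀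

  toK : ℤ[θ] → K D
  toK p = emb 1 (double p)

  toK-homomorphism : Homomorphism ℤ[θ]-algebra (K-algebra D)
  toK-homomorphism = record
    { ⟦_⟧    = toK
    ; +-homo = λ p q → trans (cong (emb 1) (double-+ p q)) (emb-+ 1 (double p) (double q))
    ; *-homo = λ p q → begin
        emb 1 (double (p *θ q))            ≡⟨ emb-2· 1 (double (p *θ q)) ⟨
        emb 2 (+ 2 √D.·θ double (p *θ q))  ≡⟨ cong (emb 2) (double-* p q) ⟨
        emb 2 (double p √D.*θ double q)    ≡⟨ emb-* 1 1 (double p) (double q) ⟩
        toK p *K toK q                     ∎
    ; ·-homo = λ u p → begin
        emb 1 (double (u ·θ p))            ≡⟨ cong (emb 1) (double-· u p) ⟨
        emb 1 (√D.fromℤ u √D.*θ double p)  ≡⟨ emb-* 0 1 (√D.fromℤ u) (double p) ⟩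
        emb 0 (√D.fromℤ u) *K toK p        ≡⟨ cong (_*K toK p) (emb-ιK u) ⟩
        ιK u *K toK p                      ∎
    ; 1-homo = refl
    }

  open Homomorphism toK-homomorphism using (solves-homo; solves-reflect; *³-homo)

  toK-0θ : toK 0θ ≡ 0K
  toK-0θ = emb-0θ 1

  toK-injective : m ≢ 0 → Injective _≡_ _≡_ toK
  toK-injective m≢0 {s , t} {s′ , t′} eq = cong₂ _,_ s≡s′ t≡t′
    where
    double≡ : double (s , t) ≡ double (s′ , t′)
    double≡ = emb-injective 1 eq
    t≡t′ : t ≡ t′
    t≡t′ = ℤP.*-cancelʳ-≡ t t′ (+ m) {{ℕ.≢-nonZero m≢0}} (cong proj₂ double≡)
    s≡s′ : s ≡ s′
    s≡s′ = ℤP.*-cancelˡ-≡ (+ 2) s s′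
      (linear-combination₂ (+ 1) (- T) (lemma T s t s′ t′) (cong proj₁ double≡) t≡t′)
      where lemma : ∀ T s t s′ t′ → + 2 * s - + 2 * s′
                      ≡ + 1 * (+ 2 * s + t * T - (+ 2 * s′ + t′ * T)) + - T * (t - t′)
            lemma = solve-∀

  -- toK (s , t) is a root of X² − (2s + tT) X + norm (s , t)
  toK-integral : ∀ p → IsAlgebraicInteger D (toK p)
  toK-integral p@(s , t) = 1 , coefficients , (begin
    (toK p ^K 2) +K polySum 2 coefficients (toK p)   ≡⟨ emb-horner 2 coefficients (double p) ⟨
    emb 2 (√D.horner 2 coefficients (double p))      ≡⟨ cong (emb 2) horner≡0θ ⟩
    emb 2 √D.0θ                                      ≡⟨ emb-0θ 2 ⟩
    0K                                               ∎)
    where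
    σ = + 2 * s + t * T
    τ = t * + m
    coefficients : Fin 2 → ℤ
    coefficients Fin.zero    = norm p
    coefficients (Fin.suc _) = - σ
    horner≡0θ : √D.horner 2 coefficients (double p) ≡ √D.0θ
    horner≡0θ = cong₂ _,_ (linear-combination₁ (- + 1) (lemma₁ D σ τ (norm p)) (norm-double p)) (lemma₂ D σ τ)
      where
      lemma₁ : ∀ D σ τ c →
        + 4 * c + (σ * (+ 2 * - σ + (σ * + 1 + D * (τ * + 0))) + D * (τ * (+ 0 + (σ * + 0 + τ * + 1 + + 0 * (τ * + 0)))))
          - + 0
        ≡ - + 1 * (σ * σ + + 0 * σ * τ - D * (τ * τ) - + 4 * c)
      lemma₁ = solve-∀
      lemma₂ : ∀ D σ τ →
        + 0 + (σ * (+ 0 + (σ * + 0 + τ * + 1 + + 0 * (τ * + 0))) + τ * (+ 2 * - σ + (σ * + 1 + D * (τ * + 0)))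
               + + 0 * (τ * (+ 0 + (σ * + 0 + τ * + 1 + + 0 * (τ * + 0)))))
        ≡ + 0
      lemma₂ = solve-∀

  toK-half-form : ∀ p → HalfFormDiv D m (toK p)
  toK-half-form (s , t) = + 2 * s + t * T , t * + m , ∣⇒∣ᵤ (divides t refl) , emb-1 (+ 2 * s + t * T) (t * + m)

  -- σ² − (tT)² = norm (σ , tm) + 4Nt², so σ ≡ tT (mod 2) when that norm is even
  even-norm⇒double : ∀ σ t → Even (√D.norm (σ , t * + m)) → ∃ λ p → double p ≡ (σ , t * + m)
  even-norm⇒double σ t (k , norm≡2k) = from-parity (even[x²-y²]⇒even[x-y] σ (t * T) (k + + 2 * (N * (t * t)) ,
    linear-combination₂ (+ 1) (- (t * t)) (lemma T N D (+ m) σ t k) norm≡2k disc))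
    where
    lemma : ∀ T N D m σ t k → σ * σ - (t * T) * (t * T) - + 2 * (k + + 2 * (N * (t * t)))
              ≡ + 1 * (σ * σ + + 0 * σ * (t * m) - D * ((t * m) * (t * m)) - + 2 * k)
                + - (t * t) * (T * T + + 4 * N - (m * m) * D)
    lemma = solve-∀
    from-parity : Even (σ - t * T) → ∃ λ p → double p ≡ (σ , t * + m)
    from-parity (s , σ-tT≡2s) = (s , t) , cong (_, t * + m) (sym (linear-combination₁ (+ 1) (lemma′ σ s (t * T)) σ-tT≡2s))
      where lemma′ : ∀ σ s x → σ - (+ 2 * s + x) ≡ + 1 * (σ - x - + 2 * s)
            lemma′ = solve-∀

  integral-half-form⇒image : ∀ x → IsAlgebraicInteger D x → HalfFormDiv D m x → ∃ λ p → x ≡ toK p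
  integral-half-form⇒image x integral (σ , τ , m∣τ , x≡) = in-image {τ} (∣ᵤ⇒∣ m∣τ) x≡
    where
    in-image : ∀ {τ} → + m Signed.∣ τ → x ≡ (σ ℚ./ 2) +√ (τ ℚ./ 2) → ∃ λ p → x ≡ toK p
    in-image (divides t refl) x≡ =
      from-double (even-norm⇒double σ t (integral-half⇒even-norm (σ , t * + m) (subst (IsAlgebraicInteger D) x≡emb integral)))
      where
      x≡emb : x ≡ emb 1 (σ , t * + m)
      x≡emb = trans x≡ (sym (emb-1 σ (t * + m)))
      from-double : (∃ λ p → double p ≡ (σ , t * + m)) → ∃ λ p → x ≡ toK p
      from-double (p , double≡) = p , trans x≡emb (cong (emb 1) (sym double≡))

  Solvable⇔QuadEqSolvable : ¬ IsSquare (T * T + + 4 * N) → m ≢ 0 → ∀ u v w i j k →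
    Solvable u v w i j k ⇔ QuadEqSolvable D m u v w i j k
  Solvable⇔QuadEqSolvable non-square m≢0 u v w i j k = mk⇔ to from
    where
    to : Solvable u v w i j k → QuadEqSolvable D m u v w i j k
    to (p , q , r , eq , norm≢0) =
      toK p , toK q , toK r , toK-integral p , toK-integral q , toK-integral r ,
      toK-half-form p , toK-half-form q , toK-half-form r , solves-homo u v w i j k eq ,
      λ xyz≡0 → norm≢0 (trans (cong norm (toK-injective m≢0 {p *θ q *θ r} {0θ}
        (trans (*³-homo p q r) (trans xyz≡0 (sym toK-0θ))))) norm-0θ)
    from : QuadEqSolvable D m u v w i j k → Solvable u v w i j k
    from (x , y , z , x-integral , y-integral , z-integral , x-half , y-half , z-half , eq , xyz≢0) =
      from-image (integral-half-form⇒image x x-integral x-half) (integral-half-form⇒image y y-integral y-half)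
                 (integral-half-form⇒image z z-integral z-half) eq xyz≢0
      where
      from-image : ∀ {x y z} → (∃ λ p → x ≡ toK p) → (∃ λ q → y ≡ toK q) → (∃ λ r → z ≡ toK r) →
        RawℤAlgebra.Solves (K-algebra D) u v w i j k x y z → (x *K y) *K z ≢ 0K → Solvable u v w i j k
      from-image (p , refl) (q , refl) (r , refl) eq xyz≢0 =
        p , q , r , solves-reflect (toK-injective m≢0) u v w i j k eq ,
        norm≢0 non-square (p *θ q *θ r) (λ pqr≡0 → xyz≢0 (trans (sym (*³-homo p q r)) (trans (cong toK pqr≡0) toK-0θ)))

theorem3p3 : (a b c : ℤ) → b * c ≢ + 0 → gcd (gcd a b) c ≡ + 1 →
    (u v w : ℤ) → u ≢ + 0 → v ≢ + 0 → w ≢ + 0 → gcd (gcd u v) w ≡ + 1 →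
    (i j k : ℕ) → i > 0 → j > 0 → k > 0 →
    (IsSquare (a * a + + 4 * (b * c)) →
       (MatrixEqSolvable (mat a b c (+ 0)) u v w i j k ⇔ IntEqSolvable u v w i j k))
    ×
    (¬ IsSquare (a * a + + 4 * (b * c)) →
       (D : ℤ) (m : ℕ) → SquareFree D → m > 0 → a * a + + 4 * (b * c) ≡ (+ m * + m) * D →
       (MatrixEqSolvable (mat a b c (+ 0)) u v w i j k ⇔ QuadEqSolvable D m u v w i j k))
theorem3p3 a b c bc≢0 gcd≡1 u v w _ _ _ _ i j k _ _ _ = split , non-split
  where
  centraliser⇔ : MatrixEqSolvable (mat a b c (+ 0)) u v w i j k ⇔ QuadraticRing.Solvable a (b * c) u v w i j k
  centraliser⇔ = Centraliser.MatrixEqSolvable⇔Solvable a b c (λ b≡0 → bc≢0 (cong (_* c) b≡0)) gcd≡1 u v w i j k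

  split : IsSquare (a * a + + 4 * (b * c)) →
    MatrixEqSolvable (mat a b c (+ 0)) u v w i j k ⇔ IntEqSolvable u v w i j k
  split (r , disc≡r²) = from-root (square-discriminant⇒root a (b * c) r disc≡r²)
    where
    from-root : (∃ λ ℓ → ℓ * ℓ ≡ a * ℓ + b * c) →
      MatrixEqSolvable (mat a b c (+ 0)) u v w i j k ⇔ IntEqSolvable u v w i j k
    from-root (ℓ , root) = QuadraticRing.Solvable⇔IntEqSolvable a (b * c) ℓ root u v w i j k ⇔-∘ centraliser⇔

  non-split : ¬ IsSquare (a * a + + 4 * (b * c)) → (D : ℤ) (m : ℕ) → SquareFree D → m > 0 →
    a * a + + 4 * (b * c) ≡ (+ m * + m) * D →
    MatrixEqSolvable (mat a b c (+ 0)) u v w i j k ⇔ QuadEqSolvable D m u v w i j k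
  non-split non-square D m _ m>0 disc =
    NonSplitCase.Solvable⇔QuadEqSolvable a (b * c) D m disc non-square (ℕP.n>0⇒n≢0 m>0) u v w i j k ⇔-∘ centraliser⇔
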